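{- There is an absolute constant $c>0$ such that for every prime $p$ and every integer $\lambda$ with $1\le\lambda\le p-1$, the set $A=\{1,2,\ldots,\lambda\}\subseteq\mathbb{F}_p^*$ satisfies $$|AA^{ -1}|\ge c\,\min\{\lambda^2,p\},$$ where $AA^{ -1}=\{ab^{ -1}: a,b\in A\}$ is computed in the multiplicative group $\mathbb{F}_p^*$.
   Context: $\mathbb{F}_p$ is the field with $p$ elements, identified with the residues $\{0,1,\dots,p-1\}$ (so $\{1,\dots,\lambda\}$ denotes the corresponding residue classes), and $\mathbb{F}_p^*$ is its multiplicative group. -}

module Defs where

open import Data.Nat using (ℕ; zero; suc; _*_; _≟_)
open import Data.Nat.DivMod using (_%_)
open import Data.List using (List; map; upTo; filter; length)
open import Data.List.Relation.Unary.Any using (Any; any?)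
open import Relation.Binary.PropositionalEquality using (_≡_)
open import Relation.Nullary using (Dec)

range1 : ℕ → List ℕ
range1 l = map suc (upTo l)

-- For p = suc q (so p ≥ 1): x (a residue in {0,…,p-1}) lies in A·A⁻¹ with
-- A = {1,…,l}, i.e. x = a·b⁻¹ in F_p for some a, b ∈ A, i.e. x·b = a in F_p.
IsQuot : (q l x : ℕ) → Set
IsQuot q l x = Any (λ a → Any (λ b → (x * b) % suc q ≡ a % suc q) (range1 l)) (range1 l)

isQuot? : (q l x : ℕ) → Dec (IsQuot q l x)
isQuot? q l x = any? (λ a → any? (λ b → ((x * b) % suc q) ≟ (a % suc q)) (range1 l)) (range1 l)

-- |A A⁻¹| for A = {1,…,l} ⊆ F_p^*, counted as residues in {0,…,p-1}.
-- (p = 0 is meaningless; value 0 there, never used since p is prime.)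
quotSetSize : (p l : ℕ) → ℕ
quotSetSize zero l = 0
quotSetSize (suc q) l = length (filter (isQuot? q l) (upTo (suc q)))

-- A pair (a, b) ∈ [1,m]² with gcd(a, b) = 1 determines the residue a b⁻¹ (mod p), and when
-- m² < p distinct such pairs give distinct residues: a b⁻¹ ≡ a' b'⁻¹ forces a b' ≡ a' b (mod p),
-- both sides are below p, so a b' = a' b, hence (a, b) = (a', b') by coprimality. So for m ≤ λ
-- with m² < p, |AA⁻¹| is at least the number of coprime pairs in [1,m]². That number is at least
-- m²/4: the pairs with common divisor d ≥ 2 number at most ⌊m/d⌋², and
-- Σ_{d≥2} ⌊m/d⌋² ≤ m²/4 + Σ_{d≥3} m²/(d(d−1)) = 3m²/4.
-- If λ² < p take m = λ; otherwise take m = ⌊√(p−1)⌋, for which p ≤ (m+1)² ≤ 4m².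
module Submission where

open import Data.Empty using (⊥-elim)
open import Data.List using (List; []; _∷_; map; filter; length; upTo; iterate; cartesianProduct)
open import Data.List.Properties using (length-map; length-upTo; length-++)
open import Data.List.Membership.Propositional using (_∈_; lose)
open import Data.List.Membership.Propositional.Properties using (∈-map⁺; ∈-map⁻; ∈-upTo⁺; ∈-upTo⁻; ∈-filter⁺; ∈-filter⁻; ∈-cartesianProduct⁺; ∈-cartesianProduct⁻)
import Data.List.Relation.Unary.All as All
import Data.List.Relation.Unary.All.Properties as All
open import Data.List.Relation.Unary.Any using (here; there)
open import Data.List.Relation.Unary.Unique.Propositional using (Unique; []; _∷_)
import Data.List.Relation.Unary.Unique.Propositional.Properties as Unique
open import Data.List.Relation.Binary.Subset.Propositional using (_⊆_)
import Data.List.Relation.Binary.Sublist.Propositional as Sublist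
import Data.List.Relation.Binary.Sublist.Propositional.Properties as Sublist
open import Data.Nat
open import Data.Nat.Properties
open import Data.Nat.DivMod
open import Data.Nat.Divisibility using (_∣_; _∣?_; divides; ∣-antisym; ∣⇒≤; 0∣⇒≡0)
open import Data.Nat.GCD using (gcd; gcd[m,n]∣m; gcd[m,n]∣n; module GCD; module Bézout)
open import Data.Nat.Coprimality using (Coprime; coprime?; coprime-divisor; coprime⇒GCD≡1; gcd≡1⇒coprime; prime⇒coprime)
open import Data.Nat.ListAction using (sum)
open import Data.Nat.Primality using (Prime; ¬prime[1])
open import Data.Nat.Tactic.RingSolver using (solve; solve-∀)
open import Data.Product using (∃-syntax; _×_; _,_; proj₁; proj₂; uncurry)
open import Level using (0ℓ)
open import Relation.Binary.PropositionalEquality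
open import Relation.Nullary using (¬_; yes; no; _×-dec_)
open import Relation.Unary using (Pred; Decidable)
open import Relation.Unary.Properties using (∁?)
open import Defs

module _ {A : Set} where

  remove : ∀ {x} (ys : List A) → x ∈ ys → List A
  remove (_ ∷ ys) (here _)  = ys
  remove (y ∷ ys) (there p) = y ∷ remove ys p

  length-remove : ∀ {x} (ys : List A) (x∈ys : x ∈ ys) → length ys ≡ suc (length (remove ys x∈ys))
  length-remove (_ ∷ _)  (here _)  = refl
  length-remove (_ ∷ ys) (there p) = cong suc (length-remove ys p)

  ∈-remove⁺ : ∀ {x z} (ys : List A) (x∈ys : x ∈ ys) → z ∈ ys → x ≢ z → z ∈ remove ys x∈ys
  ∈-remove⁺ (_ ∷ _)  (here refl) (here refl) x≢z = ⊥-elim (x≢z refl)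
  ∈-remove⁺ (_ ∷ _)  (here refl) (there z∈) _   = z∈
  ∈-remove⁺ (_ ∷ _)  (there _)   (here refl) _   = here refl
  ∈-remove⁺ (_ ∷ ys) (there p)   (there z∈) x≢z = there (∈-remove⁺ ys p z∈ x≢z)

  Unique-⊆⇒length-≤ : ∀ {xs ys : List A} → Unique xs → xs ⊆ ys → length xs ≤ length ys
  Unique-⊆⇒length-≤ {[]}     _           _     = z≤n
  Unique-⊆⇒length-≤ {x ∷ xs} {ys} (x∉xs ∷ u) xs⊆ys = begin
    suc (length xs)                ≤⟨ s≤s (Unique-⊆⇒length-≤ u xs⊆rest) ⟩
    suc (length (remove ys x∈ys))  ≡⟨ length-remove ys x∈ys ⟨
    length ys                      ∎
    where
    open ≤-Reasoning
    x∈ys : x ∈ ys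
    x∈ys = xs⊆ys (here refl)
    xs⊆rest : xs ⊆ remove ys x∈ys
    xs⊆rest z∈xs = ∈-remove⁺ ys x∈ys (xs⊆ys (there z∈xs)) (All.lookup x∉xs z∈xs)

  map⁺-injectiveOn : ∀ {B : Set} (f : A → B) {xs} →
                     (∀ {x y} → x ∈ xs → y ∈ xs → f x ≡ f y → x ≡ y) →
                     Unique xs → Unique (map f xs)
  map⁺-injectiveOn f {[]}     _   []          = []
  map⁺-injectiveOn f {x ∷ xs} inj (x∉xs ∷ u) =
    All.map⁺ (All.tabulate λ y∈xs fx≡fy → All.lookup x∉xs y∈xs (inj (here refl) (there y∈xs) fx≡fy))
    ∷ map⁺-injectiveOn f (λ x∈ y∈ → inj (there x∈) (there y∈)) u

  length-filter-+-∁ : ∀ {P : Pred A 0ℓ} (P? : Decidable P) xs →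
                      length (filter P? xs) + length (filter (∁? P?) xs) ≡ length xs
  length-filter-+-∁ P? []       = refl
  length-filter-+-∁ P? (x ∷ xs) with P? x
  ... | yes _ = cong suc (length-filter-+-∁ P? xs)
  ... | no _  = trans (+-suc _ _) (cong suc (length-filter-+-∁ P? xs))

  length-≤-sum-filter : ∀ {D : Set} {Q : D → Pred A 0ℓ} (Q? : ∀ d → Decidable (Q d)) (ds : List D)
                        {xs ys : List A} → xs Sublist.⊆ ys → (∀ {x} → x ∈ xs → ∃[ d ] d ∈ ds × Q d x) →
                        length xs ≤ sum (map (λ d → length (filter (Q? d) ys)) ds)
  length-≤-sum-filter Q? [] {[]}    _ _ = z≤n
  length-≤-sum-filter Q? [] {_ ∷ _} _ covered with covered (here refl)
  ... | _ , () , _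
  length-≤-sum-filter {Q = Q} Q? (d ∷ ds) {xs} {ys} xs⊑ys covered = begin
    length xs
      ≡⟨ length-filter-+-∁ (Q? d) xs ⟨
    length (filter (Q? d) xs) + length (filter (∁? (Q? d)) xs)
      ≤⟨ +-mono-≤ (Sublist.length-mono-≤ (Sublist.filter⁺ (Q? d) (Q? d) (λ { refl q → q }) xs⊑ys))
                  (length-≤-sum-filter Q? ds (Sublist.⊆-trans (Sublist.filter-⊆ (∁? (Q? d)) xs) xs⊑ys) coveredRest) ⟩
    length (filter (Q? d) ys) + sum (map (λ d → length (filter (Q? d) ys)) ds)
      ∎
    where
    open ≤-Reasoning
    coveredRest : ∀ {x} → x ∈ filter (∁? (Q? d)) xs → ∃[ d' ] d' ∈ ds × Q d' x
    coveredRest x∈ with ∈-filter⁻ (∁? (Q? d)) x∈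
    ... | x∈xs , ¬Qdx with covered x∈xs
    ... | _ , here refl , Qdx  = ⊥-elim (¬Qdx Qdx)
    ... | e , there e∈ds , Qex = e , e∈ds , Qex

length-cartesianProduct : ∀ {A B : Set} (xs : List A) (ys : List B) →
                          length (cartesianProduct xs ys) ≡ length xs * length ys
length-cartesianProduct []       ys = refl
length-cartesianProduct (x ∷ xs) ys =
  trans (length-++ (map (x ,_) ys)) (cong₂ _+_ (length-map (x ,_) ys) (length-cartesianProduct xs ys))

sum-map-mono-≤ : ∀ {D : Set} {f g : D → ℕ} → (∀ d → f d ≤ g d) → ∀ ds → sum (map f ds) ≤ sum (map g ds)
sum-map-mono-≤ f≤g []       = z≤n
sum-map-mono-≤ f≤g (d ∷ ds) = +-mono-≤ (f≤g d) (sum-map-mono-≤ f≤g ds)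

∈-iterate-suc⁺ : ∀ {e} k n → k ≤ e → e < k + n → e ∈ iterate suc k n
∈-iterate-suc⁺ {e} k zero    k≤e e<k+0 = ⊥-elim (<⇒≱ (subst (e <_) (+-identityʳ k) e<k+0) k≤e)
∈-iterate-suc⁺ {e} k (suc n) k≤e e<k+n with k ≟ e
... | yes refl = here refl
... | no k≢e   = there (∈-iterate-suc⁺ (suc k) n (≤∧≢⇒< k≤e k≢e) (subst (e <_) (+-suc k n) e<k+n))

%-cong-*ʳ : ∀ n .{{_ : NonZero n}} {a b} c → a % n ≡ b % n → (a * c) % n ≡ (b * c) % n
%-cong-*ʳ n {a} {b} c a≡b = begin
  (a * c) % n              ≡⟨ %-distribˡ-* a c n ⟩
  ((a % n) * (c % n)) % n  ≡⟨ cong (λ t → (t * (c % n)) % n) a≡b ⟩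
  ((b % n) * (c % n)) % n  ≡⟨ %-distribˡ-* b c n ⟨
  (b * c) % n              ∎
  where open ≡-Reasoning

inverseMod : ℕ → ℕ → ℕ
inverseMod n b with Bézout.lemma n b
... | Bézout.result _ _ (Bézout.+- _ y _) = y * (n ∸ 1)
... | Bézout.result _ _ (Bézout.-+ _ y _) = y

inverseMod-correct : ∀ n .{{_ : NonZero n}} {b} → Coprime n b → (inverseMod n b * b) % n ≡ 1 % n
inverseMod-correct n@(suc k) {b} n⊥b with Bézout.lemma n b
... | Bézout.result d g (Bézout.-+ x y eq) rewrite GCD.unique g (coprime⇒GCD≡1 n⊥b) = begin
  (y * b) % n      ≡⟨ cong (_% n) eq ⟨
  (1 + x * n) % n  ≡⟨ [m+kn]%n≡m%n 1 x n ⟩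
  1 % n            ∎
  where open ≡-Reasoning
... | Bézout.result d g (Bézout.+- x y eq) rewrite GCD.unique g (coprime⇒GCD≡1 n⊥b) = begin
  (y * k * b) % n            ≡⟨ [m+n]%n≡m%n (y * k * b) n ⟨
  (y * k * b + n) % n        ≡⟨ cong (_% n) rearrange ⟩
  (1 + k * (1 + y * b)) % n  ≡⟨ cong (λ t → (1 + k * t) % n) eq ⟩
  (1 + k * (x * n)) % n      ≡⟨ cong (λ t → (1 + t) % n) (*-assoc k x n) ⟨
  (1 + k * x * n) % n        ≡⟨ [m+kn]%n≡m%n 1 (k * x) n ⟩
  1 % n                      ∎
  where
  open ≡-Reasoning
  rearrange : y * k * b + suc k ≡ 1 + k * (1 + y * b)
  rearrange = solve (y ∷ k ∷ b ∷ [])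

quotientMod : (n : ℕ) .{{_ : NonZero n}} → ℕ × ℕ → ℕ
quotientMod n (a , b) = (a * inverseMod n b) % n

quotientMod-correct : ∀ n .{{_ : NonZero n}} {a b} → Coprime n b → (quotientMod n (a , b) * b) % n ≡ a % n
quotientMod-correct n {a} {b} n⊥b = begin
  ((a * c) % n * b) % n  ≡⟨ %-cong-*ʳ n b (m%n%n≡m%n (a * c) n) ⟩
  (a * c * b) % n        ≡⟨ cong (_% n) (trans (*-assoc a c b) (*-comm a (c * b))) ⟩
  (c * b * a) % n        ≡⟨ %-cong-*ʳ n a (inverseMod-correct n n⊥b) ⟩
  (1 * a) % n            ≡⟨ cong (_% n) (*-identityˡ a) ⟩
  a % n                  ∎
  where
  open ≡-Reasoning
  c : ℕ
  c = inverseMod n b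

cross-multiply-mod : ∀ n .{{_ : NonZero n}} {x a b a' b'} →
                     (x * b) % n ≡ a % n → (x * b') % n ≡ a' % n → (a * b') % n ≡ (a' * b) % n
cross-multiply-mod n {x} {a} {b} {a'} {b'} xb≡a xb'≡a' = begin
  (a * b') % n      ≡⟨ %-cong-*ʳ n b' xb≡a ⟨
  (x * b * b') % n  ≡⟨ cong (_% n) (solve (x ∷ b ∷ b' ∷ [])) ⟩
  (x * b' * b) % n  ≡⟨ %-cong-*ʳ n b xb'≡a' ⟩
  (a' * b) % n      ∎
  where open ≡-Reasoning

coprime-cross-≡ : ∀ {a b a' b'} → Coprime a b → Coprime a' b' → 0 < a →
                  a * b' ≡ a' * b → (a , b) ≡ (a' , b')
coprime-cross-≡ {a} {b} {a'} {b'} a⊥b a'⊥b' 0<a ab'≡a'b = cong₂ _,_ a≡a' b≡b'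
  where
  a≡a' : a ≡ a'
  a≡a' = ∣-antisym
    (coprime-divisor a⊥b (divides b' (trans (*-comm b a') (trans (sym ab'≡a'b) (*-comm a b')))))
    (coprime-divisor a'⊥b' (divides b (trans (*-comm b' a) (trans ab'≡a'b (*-comm a' b)))))
  b≡b' : b ≡ b'
  b≡b' = *-cancelˡ-≡ b b' a {{>-nonZero 0<a}} (trans (cong (_* b) a≡a') (sym ab'≡a'b))

∈-range1⁺ : ∀ {x l} → 1 ≤ x → x ≤ l → x ∈ range1 l
∈-range1⁺ {suc x} _ x<l = ∈-map⁺ suc (∈-upTo⁺ x<l)

∈-range1⁻ : ∀ {x l} → x ∈ range1 l → 1 ≤ x × x ≤ l
∈-range1⁻ x∈ with ∈-map⁻ suc x∈
... | _ , y∈ , refl = s≤s z≤n , ∈-upTo⁻ y∈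

pairs : ℕ → List (ℕ × ℕ)
pairs m = cartesianProduct (range1 m) (range1 m)

∈-pairs⁺ : ∀ {m a b} → 1 ≤ a → a ≤ m → 1 ≤ b → b ≤ m → (a , b) ∈ pairs m
∈-pairs⁺ 1≤a a≤m 1≤b b≤m = ∈-cartesianProduct⁺ (∈-range1⁺ 1≤a a≤m) (∈-range1⁺ 1≤b b≤m)

∈-pairs⁻ : ∀ {m a b} → (a , b) ∈ pairs m → (1 ≤ a × a ≤ m) × (1 ≤ b × b ≤ m)
∈-pairs⁻ {m} ab∈ with ∈-cartesianProduct⁻ (range1 m) (range1 m) ab∈
... | a∈ , b∈ = ∈-range1⁻ a∈ , ∈-range1⁻ b∈

pairs-unique : ∀ m → Unique (pairs m)
pairs-unique m = Unique.cartesianProduct⁺ range1-unique range1-unique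
  where
  range1-unique : Unique (range1 m)
  range1-unique = Unique.map⁺ suc-injective (Unique.upTo⁺ m)

length-pairs : ∀ m → length (pairs m) ≡ m * m
length-pairs m = begin
  length (pairs m)                       ≡⟨ length-cartesianProduct (range1 m) (range1 m) ⟩
  length (range1 m) * length (range1 m)   ≡⟨ cong₂ _*_ length-range1 length-range1 ⟩
  m * m                                  ∎
  where
  open ≡-Reasoning
  length-range1 : length (range1 m) ≡ m
  length-range1 = trans (length-map suc (upTo m)) (length-upTo m)

coprimePairs : ℕ → List (ℕ × ℕ)
coprimePairs m = filter (uncurry coprime?) (pairs m)

∈-coprimePairs⁻ : ∀ {m a b} → (a , b) ∈ coprimePairs m → ((1 ≤ a × a ≤ m) × (1 ≤ b × b ≤ m)) × Coprime a b
∈-coprimePairs⁻ {m} ab∈ with ∈-filter⁻ (uncurry coprime?) {xs = pairs m} ab∈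
... | ab∈pairs , a⊥b = ∈-pairs⁻ ab∈pairs , a⊥b

CommonDivisor : ℕ → Pred (ℕ × ℕ) 0ℓ
CommonDivisor d (a , b) = d ∣ a × d ∣ b

commonDivisor? : ∀ d → Decidable (CommonDivisor d)
commonDivisor? d (a , b) = d ∣? a ×-dec d ∣? b

length-commonMultiples : ∀ m d .{{_ : NonZero d}} → length (filter (commonDivisor? d) (pairs m)) ≤ (m / d) * (m / d)
length-commonMultiples m d = begin
  length multiples               ≡⟨ length-map shrink multiples ⟨
  length (map shrink multiples)  ≤⟨ Unique-⊆⇒length-≤ shrink-unique shrink-⊆ ⟩
  length (pairs (m / d))         ≡⟨ length-pairs (m / d) ⟩
  (m / d) * (m / d)              ∎
  where
  open ≤-Reasoning
  multiples : List (ℕ × ℕ)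
  multiples = filter (commonDivisor? d) (pairs m)

  shrink : ℕ × ℕ → ℕ × ℕ
  shrink (a , b) = a / d , b / d

  shrink-injective : ∀ {x y} → x ∈ multiples → y ∈ multiples → shrink x ≡ shrink y → x ≡ y
  shrink-injective {a , b} {a' , b'} x∈ y∈ eq
    with ∈-filter⁻ (commonDivisor? d) {xs = pairs m} x∈ | ∈-filter⁻ (commonDivisor? d) {xs = pairs m} y∈
  ... | _ , d∣a , d∣b | _ , d∣a' , d∣b' =
    cong₂ _,_ (/-cancelʳ-≡ d∣a d∣a' (cong proj₁ eq)) (/-cancelʳ-≡ d∣b d∣b' (cong proj₂ eq))

  shrink-unique : Unique (map shrink multiples)
  shrink-unique = map⁺-injectiveOn shrink shrink-injective (Unique.filter⁺ (commonDivisor? d) (pairs-unique m))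

  quotient-positive : ∀ {a} → 1 ≤ a → d ∣ a → 1 ≤ a / d
  quotient-positive {suc _} _ d∣a = m≥n⇒m/n>0 (∣⇒≤ d∣a)

  shrink-⊆ : map shrink multiples ⊆ pairs (m / d)
  shrink-⊆ z∈ with ∈-map⁻ shrink z∈
  ... | (a , b) , x∈ , refl with ∈-filter⁻ (commonDivisor? d) {xs = pairs m} x∈
  ... | x∈pairs , d∣a , d∣b with ∈-pairs⁻ x∈pairs
  ... | (1≤a , a≤m) , (1≤b , b≤m) =
    ∈-pairs⁺ (quotient-positive 1≤a d∣a) (/-monoˡ-≤ d a≤m) (quotient-positive 1≤b d∣b) (/-monoˡ-≤ d b≤m)

squaredQuotient : ℕ → ℕ → ℕ
squaredQuotient m e = (m / suc e) * (m / suc e)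

-- ⌊m/(k+1)⌋² ≤ m²/(k(k+1)) = m²/k − m²/(k+1), so the tail sum telescopes.
tail-sum-squaredQuotient : ∀ m k n → k * sum (map (squaredQuotient m) (iterate suc k n)) ≤ m * m
tail-sum-squaredQuotient m k zero    = ≤-trans (≤-reflexive (*-zeroʳ k)) z≤n
tail-sum-squaredQuotient m k (suc n) = *-cancelˡ-≤ (suc k) (begin
  suc k * (k * (u * u + T))                 ≡⟨ regroup k u T ⟩
  (suc k * u) * (k * u) + k * (suc k * T)   ≤⟨ +-mono-≤ (*-mono-≤ [1+k]u≤m ku≤m) (*-monoʳ-≤ k (tail-sum-squaredQuotient m (suc k) n)) ⟩
  suc k * (m * m)                           ∎)
  where
  open ≤-Reasoning
  regroup : ∀ k u T → suc k * (k * (u * u + T)) ≡ (suc k * u) * (k * u) + k * (suc k * T)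
  regroup = solve-∀
  u T : ℕ
  u = m / suc k
  T = sum (map (squaredQuotient m) (iterate suc (suc k) n))
  [1+k]u≤m : suc k * u ≤ m
  [1+k]u≤m = ≤-trans (≤-reflexive (*-comm (suc k) u)) (m/n*n≤m m (suc k))
  ku≤m : k * u ≤ m
  ku≤m = ≤-trans (*-monoˡ-≤ u (n≤1+n k)) [1+k]u≤m

sum-squaredQuotient : ∀ m n → 4 * sum (map (squaredQuotient m) (iterate suc 1 n)) ≤ 3 * (m * m)
sum-squaredQuotient m zero    = z≤n
sum-squaredQuotient m (suc n) = begin
  4 * (u * u + T)                  ≡⟨ regroup u T ⟩
  (2 * u) * (2 * u) + 2 * (2 * T)  ≤⟨ +-mono-≤ (*-mono-≤ 2u≤m 2u≤m) (*-monoʳ-≤ 2 (tail-sum-squaredQuotient m 2 n)) ⟩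
  m * m + 2 * (m * m)              ≡⟨ solve (m ∷ []) ⟩
  3 * (m * m)                      ∎
  where
  open ≤-Reasoning
  regroup : ∀ u T → 4 * (u * u + T) ≡ (2 * u) * (2 * u) + 2 * (2 * T)
  regroup = solve-∀
  u T : ℕ
  u = m / 2
  T = sum (map (squaredQuotient m) (iterate suc 2 n))
  2u≤m : 2 * u ≤ m
  2u≤m = ≤-trans (≤-reflexive (*-comm 2 u)) (m/n*n≤m m 2)

nonCoprime⇒commonDivisor : ∀ {m a b} → (a , b) ∈ pairs m → ¬ Coprime a b →
                           ∃[ e ] e ∈ iterate suc 1 m × CommonDivisor (suc e) (a , b)
nonCoprime⇒commonDivisor {m} {a} {b} ab∈ ¬a⊥b with ∈-pairs⁻ ab∈
... | (1≤a , a≤m) , _ with gcd a b | gcd[m,n]∣m a b | gcd[m,n]∣n a b | gcd≡1⇒coprime {a} {b}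
... | zero        | 0∣a | _   | _          = ⊥-elim (<⇒≢ 1≤a (sym (0∣⇒≡0 0∣a)))
... | suc zero    | _   | _   | 1⇒coprime = ⊥-elim (¬a⊥b (1⇒coprime refl))
... | suc (suc e) | g∣a | g∣b | _          =
  suc e , ∈-iterate-suc⁺ 1 m (s≤s z≤n) (≤-trans (∣⇒≤ {{>-nonZero 1≤a}} g∣a) (m≤n⇒m≤1+n a≤m)) , g∣a , g∣b

square≤4*coprimePairs : ∀ m → m * m ≤ 4 * length (coprimePairs m)
square≤4*coprimePairs m = +-cancelʳ-≤ (3 * (m * m)) (m * m) (4 * c) (begin
  m * m + 3 * (m * m)   ≡⟨ solve (m ∷ []) ⟩
  4 * (m * m)           ≡⟨ cong (4 *_) (length-pairs m) ⟨
  4 * length (pairs m)  ≡⟨ cong (4 *_) (length-filter-+-∁ (uncurry coprime?) (pairs m)) ⟨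
  4 * (c + c')          ≡⟨ *-distribˡ-+ 4 c c' ⟩
  4 * c + 4 * c'        ≤⟨ +-monoʳ-≤ (4 * c) (≤-trans (*-monoʳ-≤ 4 c'-bound) (sum-squaredQuotient m m)) ⟩
  4 * c + 3 * (m * m)   ∎)
  where
  open ≤-Reasoning
  nonCoprime : List (ℕ × ℕ)
  nonCoprime = filter (∁? (uncurry coprime?)) (pairs m)
  c c' : ℕ
  c  = length (coprimePairs m)
  c' = length nonCoprime
  nonCoprime-covered : ∀ {x} → x ∈ nonCoprime → ∃[ e ] e ∈ iterate suc 1 m × CommonDivisor (suc e) x
  nonCoprime-covered {a , b} x∈ with ∈-filter⁻ (∁? (uncurry coprime?)) {xs = pairs m} x∈
  ... | x∈pairs , ¬a⊥b = nonCoprime⇒commonDivisor x∈pairs ¬a⊥b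
  c'-bound : c' ≤ sum (map (squaredQuotient m) (iterate suc 1 m))
  c'-bound = ≤-trans
    (length-≤-sum-filter (λ e → commonDivisor? (suc e)) (iterate suc 1 m)
      (Sublist.filter-⊆ (∁? (uncurry coprime?)) (pairs m)) nonCoprime-covered)
    (sum-map-mono-≤ (λ e → length-commonMultiples m (suc e)) (iterate suc 1 m))

module _ {q : ℕ} (p-prime : Prime (suc q)) {m l : ℕ} (m≤l : m ≤ l) (m*m<p : m * m < suc q) where

  private
    p : ℕ
    p = suc q

    quotient : ℕ × ℕ → ℕ
    quotient = quotientMod p

    entry<p : ∀ {b} → b ≤ m → b < p
    entry<p {b} b≤m = ≤-<-trans (≤-trans b≤m (m≤m*m m)) m*m<p
      where
      m≤m*m : ∀ m → m ≤ m * m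
      m≤m*m zero    = z≤n
      m≤m*m (suc m) = m≤m*n (suc m) (suc m)

    quotient-correct : ∀ {a b} → (a , b) ∈ coprimePairs m → (quotient (a , b) * b) % p ≡ a % p
    quotient-correct {a} {b} ab∈ with ∈-coprimePairs⁻ {m} ab∈
    ... | (_ , (1≤b , b≤m)) , _ = quotientMod-correct p {a} {b} (prime⇒coprime p-prime {{>-nonZero 1≤b}} (entry<p b≤m))

    quotient-injective : ∀ {x y} → x ∈ coprimePairs m → y ∈ coprimePairs m → quotient x ≡ quotient y → x ≡ y
    quotient-injective {a , b} {a' , b'} x∈ y∈ eq with ∈-coprimePairs⁻ {m} x∈ | ∈-coprimePairs⁻ {m} y∈
    ... | ((1≤a , a≤m) , (_ , b≤m)) , a⊥b | ((_ , a'≤m) , (_ , b'≤m)) , a'⊥b' =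
      coprime-cross-≡ a⊥b a'⊥b' 1≤a (begin
        a * b'        ≡⟨ m<n⇒m%n≡m (≤-<-trans (*-mono-≤ a≤m b'≤m) m*m<p) ⟨
        (a * b') % p  ≡⟨ cross-multiply-mod p {quotient (a , b)} {a} {b} {a'} {b'} (quotient-correct x∈) xb'≡a' ⟩
        (a' * b) % p  ≡⟨ m<n⇒m%n≡m (≤-<-trans (*-mono-≤ a'≤m b≤m) m*m<p) ⟩
        a' * b        ∎)
      where
      open ≡-Reasoning
      xb'≡a' : (quotient (a , b) * b') % p ≡ a' % p
      xb'≡a' = subst (λ t → (t * b') % p ≡ a' % p) (sym eq) (quotient-correct y∈)

    quotient-⊆ : map quotient (coprimePairs m) ⊆ filter (isQuot? q l) (upTo p)
    quotient-⊆ z∈ with ∈-map⁻ quotient z∈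
    ... | (a , b) , x∈ , refl with ∈-coprimePairs⁻ x∈
    ... | ((1≤a , a≤m) , (1≤b , b≤m)) , _ =
      ∈-filter⁺ (isQuot? q l) (∈-upTo⁺ (m%n<n (a * inverseMod p b) p)) witness
      where
      witness : IsQuot q l (quotient (a , b))
      witness = lose (∈-range1⁺ 1≤a (≤-trans a≤m m≤l)) (lose (∈-range1⁺ 1≤b (≤-trans b≤m m≤l)) (quotient-correct x∈))

  length-coprimePairs≤quotSetSize : length (coprimePairs m) ≤ quotSetSize p l
  length-coprimePairs≤quotSetSize = begin
    length (coprimePairs m)                  ≡⟨ length-map quotient (coprimePairs m) ⟨
    length (map quotient (coprimePairs m))   ≤⟨ Unique-⊆⇒length-≤ quotients-unique quotient-⊆ ⟩
    quotSetSize p l                          ∎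
    where
    open ≤-Reasoning
    quotients-unique : Unique (map quotient (coprimePairs m))
    quotients-unique = map⁺-injectiveOn quotient quotient-injective
      (Unique.filter⁺ (uncurry coprime?) (pairs-unique m))

  square≤4*quotSetSize : m * m ≤ 4 * quotSetSize p l
  square≤4*quotSetSize = ≤-trans (square≤4*coprimePairs m) (*-monoʳ-≤ 4 length-coprimePairs≤quotSetSize)

floorSqrt : ∀ n → ∃[ r ] r * r ≤ n × n < suc r * suc r
floorSqrt zero = 0 , z≤n , s≤s z≤n
floorSqrt (suc n) with floorSqrt n
... | r , r*r≤n , n<[1+r]² with suc n <? suc r * suc r
... | yes 1+n<[1+r]² = r , m≤n⇒m≤1+n r*r≤n , 1+n<[1+r]²
... | no  1+n≮[1+r]² = suc r , ≮⇒≥ 1+n≮[1+r]² , ≤-<-trans n<[1+r]² (*-mono-< (n<1+n (suc r)) (n<1+n (suc r)))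

[1+r]²≤4r² : ∀ r → 1 ≤ r → suc r * suc r ≤ 4 * (r * r)
[1+r]²≤4r² r 1≤r = begin
  suc r * suc r      ≤⟨ *-mono-≤ 1+r≤2r 1+r≤2r ⟩
  (2 * r) * (2 * r)  ≡⟨ regroup r ⟩
  4 * (r * r)        ∎
  where
  open ≤-Reasoning
  1+r≤2r : suc r ≤ 2 * r
  1+r≤2r = ≤-trans (+-monoˡ-≤ r 1≤r) (≤-reflexive (cong (r +_) (sym (+-identityʳ r))))
  regroup : ∀ r → (2 * r) * (2 * r) ≡ 4 * (r * r)
  regroup = solve-∀

mainTheorem2 : ∃[ K ] (1 ≤ K × (∀ p → Prime p → ∀ l → 1 ≤ l → l ≤ p ∸ 1 →
                 (l * l) ⊓ p ≤ K * quotSetSize p l))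
mainTheorem2 = 16 , s≤s z≤n , bound
  where
  bound : ∀ p → Prime p → ∀ l → 1 ≤ l → l ≤ p ∸ 1 → (l * l) ⊓ p ≤ 16 * quotSetSize p l
  bound (suc q) p-prime l _ _ with l * l <? suc q | floorSqrt q
  ... | yes l*l<p | _ = begin
    (l * l) ⊓ suc q             ≤⟨ m⊓n≤m (l * l) (suc q) ⟩
    l * l                       ≤⟨ square≤4*quotSetSize p-prime {l} {l} ≤-refl l*l<p ⟩
    4 * quotSetSize (suc q) l   ≤⟨ *-monoˡ-≤ (quotSetSize (suc q) l) (m≤m+n 4 12) ⟩
    16 * quotSetSize (suc q) l  ∎
    where open ≤-Reasoning
  ... | no l*l≮p | zero , _ , q<1 = ⊥-elim (¬prime[1] (subst Prime (cong suc (n<1⇒n≡0 q<1)) p-prime))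
  ... | no l*l≮p | r@(suc _) , r*r≤q , q<[1+r]² = begin
    (l * l) ⊓ suc q                  ≤⟨ m⊓n≤n (l * l) (suc q) ⟩
    suc q                            ≤⟨ q<[1+r]² ⟩
    suc r * suc r                    ≤⟨ [1+r]²≤4r² r (s≤s z≤n) ⟩
    4 * (r * r)                      ≤⟨ *-monoʳ-≤ 4 (square≤4*quotSetSize p-prime {r} {l} r≤l (s≤s r*r≤q)) ⟩
    4 * (4 * quotSetSize (suc q) l)  ≡⟨ *-assoc 4 4 (quotSetSize (suc q) l) ⟨
    16 * quotSetSize (suc q) l       ∎
    where
    open ≤-Reasoning
    r≤l : r ≤ l
    r≤l = ≮⇒≥ (λ l<r → l*l≮p (≤-<-trans (*-mono-≤ (<⇒≤ l<r) (<⇒≤ l<r)) (s≤s r*r≤q)))
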